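{- Let $G$ act on a finitary affine oriented matroid $\mathscr L$ on $E$. Then the action of $G$ on $E$ is an action on the underlying semimatroid $(E,\mathcal C,\mathrm{rk})$ (it preserves $\mathcal C$ and $\mathrm{rk}$). If the action is sliding, then this action on the underlying semimatroid is translative.
   Context: Sign vectors on $E$: maps $X:E\to\{+,-,0\}$; $z(X)=\{e:X(e)=0\}$, $\underline X=E\setminus z(X)$, $S(X,Y)=\{e\in\underline X\cap\underline Y:X(e)\ne Y(e)\}$, $(X\circ Y)(e)=X(e)$ if $X(e)\ne0$ else $Y(e)$, $(X\oplus Y)(e)=0$ if $e\in S(X,Y)$ else $(X\circ Y)(e)$; componentwise order with $0<+$, $0<-$. For $\mathscr L$: $I_e(X,Y)=\{Z\in\mathscr L:Z(e)=0,\ Z(f)=(X\circ Y)(f)\ \forall f\notin S(X,Y)\}$, $I(X,Y)=\bigcup_{e\in S(X,Y)}I_e(X,Y)$, $\mathcal P(\mathscr L)=\{X\oplus(-Y):X,Y\in\mathscr L,\ I(X,-Y)=I(-X,Y)=\emptyset\}$. FAOM: (S) $|S(X,Y)|<\infty$; (Z) $|z(X)|<\infty$; (I) $\{Y\in\mathscr L:Y\le X\}$ finite; (FS) $X\circ(-Y)\in\mathscr L$; (SE) $I_e(X,Y)\ne\emptyset$ for $e\in S(X,Y)$; (P) $P\circ X\in\mathscr L$ for $P\in\mathcal P(\mathscr L)$. Underlying semimatroid: flats $\{z(X):X\in\mathscr L\}$ ordered by inclusion; $\mathcal C=\{A\subseteq E:A\subseteq z(X)\text{ for some }X\in\mathscr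 L\}$; for $A\in\mathcal C$, $\mathrm{rk}(A)$ is the maximal length of a chain of flats ending at the inclusion-minimal flat containing $A$. $G$ acts on $\mathscr L$ if $G$ acts on $E$ by permutations and $g.\mathscr L=\mathscr L$ for all $g$, where $(g.X)(e)=X(g^{ -1}(e))$. $e\parallel f$ iff no $X\in\mathscr L$ has $e,f\in z(X)$; $\pi(e)=\{e\}\cup\{f:f\parallel e\}$. The action is sliding if $g(e)\in\pi(e)$ for all $g\in G$, $e\in E$. An action on a semimatroid $(E,\mathcal C,\mathrm{rk})$ is an action on $E$ by permutations with $gX\in\mathcal C$ and $\mathrm{rk}(gX)=\mathrm{rk}(X)$ for all $X\in\mathcal C$; it is translative if $\{e,g(e)\}\in\mathcal C$ implies $g(e)=e$. -}

module Defs where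

open import Level using (Level; _⊔_) renaming (suc to lsuc; zero to 0ℓ)
open import Data.Bool using (Bool; true; false)
open import Data.Nat using (ℕ; zero; suc; _≤_)
open import Data.List using (List)
open import Data.List.Membership.Propositional using (_∈_)
open import Data.Product using (Σ; ∃; _×_; _,_)
open import Data.Sum using (_⊎_)
open import Relation.Nullary using (¬_)
open import Relation.Binary.PropositionalEquality using (_≡_)
open import Algebra.Bundles using (Group)

data Sign : Set where
  plus minus zero : Sign

negS : Sign → Sign
negS plus  = minus
negS minus = plus
negS zero  = zero

sep : Sign → Sign → Bool
sep plus  minus = true
sep minus plus  = true
sep _     _     = false

compS : Sign → Sign → Sign
compS zero t = t
compS s    _ = s

oplusS : Sign → Sign → Sign
oplusS s t with sep s t
... | true  = zero
... | false = compS s t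

SignVec : Set → Set
SignVec E = E → Sign

module _ {E : Set} where

  -ᵥ_ : SignVec E → SignVec E
  (-ᵥ X) e = negS (X e)

  _∘ᵥ_ : SignVec E → SignVec E → SignVec E
  (X ∘ᵥ Y) e = compS (X e) (Y e)

  _⊕ᵥ_ : SignVec E → SignVec E → SignVec E
  (X ⊕ᵥ Y) e = oplusS (X e) (Y e)

  InS : SignVec E → SignVec E → E → Set
  InS X Y e = sep (X e) (Y e) ≡ true

  z : SignVec E → E → Set
  z X e = X e ≡ zero

  _≗ᵥ_ : SignVec E → SignVec E → Set
  X ≗ᵥ Y = ∀ e → X e ≡ Y e

  _≤ᵥ_ : SignVec E → SignVec E → Set
  Y ≤ᵥ X = ∀ e → (Y e ≡ zero) ⊎ (Y e ≡ X e)

  FiniteSet : (E → Set) → Set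
  FiniteSet P = Σ (List E) λ l → ∀ e → P e → e ∈ l

  module _ (ℒ : SignVec E → Set) where

    InI_ : E → SignVec E → SignVec E → SignVec E → Set
    InI_ e X Y Z = ℒ Z × (Z e ≡ zero) × (∀ f → ¬ InS X Y f → Z f ≡ (X ∘ᵥ Y) f)

    IEmpty : SignVec E → SignVec E → Set
    IEmpty X Y = ¬ (Σ E λ e → Σ (SignVec E) λ Z → InS X Y e × InI_ e X Y Z)

    record IsFAOM : Set₁ where
      field
        -- well-formedness: ℒ is a set of functions, so it is closed under
        -- pointwise equality (we have no function extensionality)
        ext : ∀ X Y → X ≗ᵥ Y → ℒ X → ℒ Y
        axS  : ∀ X Y → ℒ X → ℒ Y → FiniteSet (InS X Y)
        axZ  : ∀ X → ℒ X → FiniteSet (z X)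
        axI  : ∀ X → ℒ X → Σ (List (SignVec E)) λ l →
                 ∀ Y → ℒ Y → Y ≤ᵥ X → Σ (SignVec E) λ W → (W ∈ l) × (Y ≗ᵥ W)
        axFS : ∀ X Y → ℒ X → ℒ Y → ℒ (X ∘ᵥ (-ᵥ Y))
        axSE : ∀ X Y → ℒ X → ℒ Y → ∀ e → InS X Y e →
                 Σ (SignVec E) λ Z → InI_ e X Y Z
        -- (P): P ∘ W ∈ ℒ for P = X ⊕ (-Y) ∈ 𝒫(ℒ) and W ∈ ℒ
        axP  : ∀ X Y → ℒ X → ℒ Y → IEmpty X (-ᵥ Y) → IEmpty (-ᵥ X) Y →
                 ∀ W → ℒ W → ℒ ((X ⊕ᵥ (-ᵥ Y)) ∘ᵥ W)

    _⊆_ : (E → Set) → (E → Set) → Set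
    A ⊆ B = ∀ e → A e → B e

    _≐_ : (E → Set) → (E → Set) → Set
    A ≐ B = (A ⊆ B) × (B ⊆ A)

    _⊊_ : (E → Set) → (E → Set) → Set
    A ⊊ B = (A ⊆ B) × ¬ (B ⊆ A)

    Flat : (E → Set) → Set
    Flat F = Σ (SignVec E) λ X → ℒ X × (F ≐ z X)

    InC : (E → Set) → Set
    InC A = Σ (SignVec E) λ X → ℒ X × (A ⊆ z X)

    MinFlatOver : (E → Set) → (E → Set) → Set₁
    MinFlatOver A F = Flat F × (A ⊆ F) × (∀ F′ → Flat F′ → A ⊆ F′ → F ⊆ F′)

    data Chain : (E → Set) → ℕ → Set₁ where
      start : ∀ {F} → Flat F → Chain F zero
      step  : ∀ {F F′ n} → Chain F n → Flat F′ → F ⊊ F′ → Chain F′ (suc n)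

    ChainTo : (E → Set) → ℕ → Set₁
    ChainTo F n = Σ (E → Set) λ top → Chain top n × (top ≐ F)

    IsRank : (E → Set) → ℕ → Set₁
    IsRank A n = Σ (E → Set) λ F → MinFlatOver A F × ChainTo F n ×
                   (∀ m → ChainTo F m → m ≤ n)

    _∥_ : E → E → Set
    e ∥ f = ¬ (Σ (SignVec E) λ X → ℒ X × (X e ≡ zero) × (X f ≡ zero))

record GroupAction {c ℓ : Level} (G : Group c ℓ) (E : Set) : Set (c ⊔ ℓ) where
  open Group G
  field
    act      : Carrier → E → E
    act-cong : ∀ {g h} → g ≈ h → ∀ e → act g e ≡ act h e
    act-ε    : ∀ e → act ε e ≡ e
    act-∙    : ∀ g h e → act (g ∙ h) e ≡ act g (act h e)

module _ {c ℓ : Level} {G : Group c ℓ} {E : Set} (α : GroupAction G E) where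
  open Group G
  open GroupAction α

  actV : Carrier → SignVec E → SignVec E
  actV g X e = X (act (g ⁻¹) e)

  actSet : Carrier → (E → Set) → (E → Set)
  actSet g A x = Σ E λ a → A a × (act g a ≡ x)

  ActsOn : (SignVec E → Set) → Set c
  ActsOn ℒ = ∀ g → (∀ X → ℒ X → ℒ (actV g X))
                 × (∀ Y → ℒ Y → Σ (SignVec E) λ X → ℒ X × (Y ≗ᵥ actV g X))

  IsSemimatroidAction : (SignVec E → Set) → Set (lsuc 0ℓ ⊔ c)
  IsSemimatroidAction ℒ = ∀ g A → InC ℒ A →
    InC ℒ (actSet g A) × (∀ n → IsRank ℒ A n → IsRank ℒ (actSet g A) n)

  Sliding : (SignVec E → Set) → Set c
  Sliding ℒ = ∀ g e → (act g e ≡ e) ⊎ _∥_ ℒ (act g e) e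

  Translative : (SignVec E → Set) → Set c
  Translative ℒ = ∀ g e → InC ℒ (λ x → (x ≡ e) ⊎ (x ≡ act g e)) → act g e ≡ e

{-# OPTIONS --safe #-}
module Submission where

open import Defs hiding (_⊆_; _≐_; _⊊_)
import Defs
open import Level using (Level)
open import Data.Product using (_×_; _,_; proj₁; proj₂)
open import Data.Sum using (_⊎_; inj₁; inj₂)
open import Data.Empty using (⊥-elim)
open import Relation.Nullary using (¬_)
open import Algebra.Bundles using (Group)
open import Relation.Binary.PropositionalEquality using (_≡_; refl; sym; trans; cong; subst)

-- A permutation g of E carries z(X) onto z(g.X), hence flats to flats, strict
-- inclusions to strict inclusions and chains to chains of the same length;
-- g⁻¹ carries everything back, so minimal flats and maximal chain lengths are
-- preserved too.  For translativity, {e, g e} ∈ 𝒞 says exactly that e and g e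
-- are not parallel, so a sliding g must fix e.

module _ {c ℓ : Level} {G : Group c ℓ} {E : Set} (α : GroupAction G E) where
  open Group G using (_⁻¹; inverseˡ; inverseʳ)
  open GroupAction α

  act-inverseˡ : ∀ g a → act (g ⁻¹) (act g a) ≡ a
  act-inverseˡ g a = trans (sym (act-∙ (g ⁻¹) g a)) (trans (act-cong (inverseˡ g) a) (act-ε a))

  act-inverseʳ : ∀ g a → act g (act (g ⁻¹) a) ≡ a
  act-inverseʳ g a = trans (sym (act-∙ g (g ⁻¹) a)) (trans (act-cong (inverseʳ g) a) (act-ε a))

  Invariant : (SignVec E → Set) → Set c
  Invariant ℒ = ∀ g X → ℒ X → ℒ (actV α g X)

  ActsOn⇒Invariant : ∀ {ℒ} → ActsOn α ℒ → Invariant ℒ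
  ActsOn⇒Invariant acts g = proj₁ (acts g)

  module _ (ℒ : SignVec E → Set) where

    _⊆_ : (E → Set) → (E → Set) → Set
    _⊆_ = Defs._⊆_ ℒ

    _≐_ : (E → Set) → (E → Set) → Set
    _≐_ = Defs._≐_ ℒ

    _⊊_ : (E → Set) → (E → Set) → Set
    _⊊_ = Defs._⊊_ ℒ

    ⊆-trans : ∀ {A B C} → A ⊆ B → B ⊆ C → A ⊆ C
    ⊆-trans A⊆B B⊆C e Ae = B⊆C e (A⊆B e Ae)

    ≐-trans : ∀ {A B C} → A ≐ B → B ≐ C → A ≐ C
    ≐-trans (A⊆B , B⊆A) (B⊆C , C⊆B) = ⊆-trans A⊆B B⊆C , ⊆-trans C⊆B B⊆A

    actSet-mono : ∀ g {A B} → A ⊆ B → actSet α g A ⊆ actSet α g B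
    actSet-mono g A⊆B x (a , Aa , ga≡x) = a , A⊆B a Aa , ga≡x

    actSet-cong : ∀ g {A B} → A ≐ B → actSet α g A ≐ actSet α g B
    actSet-cong g (A⊆B , B⊆A) = actSet-mono g A⊆B , actSet-mono g B⊆A

    actSet-retraction : ∀ g h → (∀ a → act h (act g a) ≡ a) →
                        ∀ A → actSet α h (actSet α g A) ≐ A
    actSet-retraction g h hg≡id A =
      (λ { x (b , (a , Aa , ga≡b) , hb≡x) →
             subst A (trans (sym (hg≡id a)) (trans (cong (act h) ga≡b) hb≡x)) Aa }) ,
      (λ x Ax → act g x , (x , Ax , refl) , hg≡id x)

    actSet-inverseˡ : ∀ g A → actSet α (g ⁻¹) (actSet α g A) ≐ A
    actSet-inverseˡ g = actSet-retraction g (g ⁻¹) (act-inverseˡ g)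

    actSet-inverseʳ : ∀ g A → actSet α g (actSet α (g ⁻¹) A) ≐ A
    actSet-inverseʳ g = actSet-retraction (g ⁻¹) g (act-inverseʳ g)

    actSet-⊊ : ∀ g {A B} → A ⊊ B → actSet α g A ⊊ actSet α g B
    actSet-⊊ g {A} {B} (A⊆B , B⊈A) = actSet-mono g A⊆B , λ gB⊆gA →
      B⊈A (⊆-trans (proj₂ (actSet-inverseˡ g B))
            (⊆-trans (actSet-mono (g ⁻¹) gB⊆gA) (proj₁ (actSet-inverseˡ g A))))

    actSet-z : ∀ g X → actSet α g (z X) ≐ z (actV α g X)
    actSet-z g X =
      (λ { x (a , Xa≡0 , ga≡x) →
             subst (λ y → z X (act (g ⁻¹) y)) ga≡x (subst (z X) (sym (act-inverseˡ g a)) Xa≡0) }) ,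
      (λ x Xg⁻¹x≡0 → act (g ⁻¹) x , Xg⁻¹x≡0 , act-inverseʳ g x)

    module _ (invariant : Invariant ℒ) where

      actSet-InC : ∀ g A → InC ℒ A → InC ℒ (actSet α g A)
      actSet-InC g A (X , ℒX , A⊆zX) =
        actV α g X , invariant g X ℒX , ⊆-trans (actSet-mono g A⊆zX) (proj₁ (actSet-z g X))

      actSet-Flat : ∀ g F → Flat ℒ F → Flat ℒ (actSet α g F)
      actSet-Flat g F (X , ℒX , F≐zX) =
        actV α g X , invariant g X ℒX , ≐-trans (actSet-cong g F≐zX) (actSet-z g X)

      actSet-Chain : ∀ g {F n} → Chain ℒ F n → Chain ℒ (actSet α g F) n
      actSet-Chain g (start flat) = start (actSet-Flat g _ flat)
      actSet-Chain g (step chain flat F⊊F′) =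
        step (actSet-Chain g chain) (actSet-Flat g _ flat) (actSet-⊊ g F⊊F′)

      actSet-ChainTo : ∀ g {F n} → ChainTo ℒ F n → ChainTo ℒ (actSet α g F) n
      actSet-ChainTo g (top , chain , top≐F) =
        actSet α g top , actSet-Chain g chain , actSet-cong g top≐F

      ChainTo-resp-≐ : ∀ {F F′ n} → F ≐ F′ → ChainTo ℒ F n → ChainTo ℒ F′ n
      ChainTo-resp-≐ F≐F′ (top , chain , top≐F) = top , chain , ≐-trans top≐F F≐F′

      actSet-MinFlatOver : ∀ g {A F} → MinFlatOver ℒ A F →
                           MinFlatOver ℒ (actSet α g A) (actSet α g F)
      actSet-MinFlatOver g {A} {F} (flat , A⊆F , minimal) =
        actSet-Flat g F flat , actSet-mono g A⊆F , λ F′ flat′ gA⊆F′ →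
          let A⊆g⁻¹F′ = ⊆-trans (proj₂ (actSet-inverseˡ g A)) (actSet-mono (g ⁻¹) gA⊆F′)
              F⊆g⁻¹F′ = minimal _ (actSet-Flat (g ⁻¹) F′ flat′) A⊆g⁻¹F′
          in ⊆-trans (actSet-mono g F⊆g⁻¹F′) (proj₁ (actSet-inverseʳ g F′))

      actSet-IsRank : ∀ g A n → IsRank ℒ A n → IsRank ℒ (actSet α g A) n
      actSet-IsRank g A n (F , minFlat , chain , maximal) =
        actSet α g F , actSet-MinFlatOver g minFlat , actSet-ChainTo g chain ,
        λ m chain′ → maximal m
          (ChainTo-resp-≐ (actSet-inverseˡ g F) (actSet-ChainTo (g ⁻¹) chain′))

      Invariant⇒IsSemimatroidAction : IsSemimatroidAction α ℒ
      Invariant⇒IsSemimatroidAction g A A∈𝒞 =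
        actSet-InC g A A∈𝒞 , λ n → actSet-IsRank g A n

    InC-pair⇒¬∥ : ∀ e f → InC ℒ (λ x → (x ≡ e) ⊎ (x ≡ f)) → ¬ _∥_ ℒ f e
    InC-pair⇒¬∥ e f (X , ℒX , pair⊆zX) f∥e = f∥e (X , ℒX , pair⊆zX f (inj₂ refl) , pair⊆zX e (inj₁ refl))

    Sliding⇒Translative : Sliding α ℒ → Translative α ℒ
    Sliding⇒Translative sliding g e pair∈𝒞 with sliding g e
    ... | inj₁ ge≡e = ge≡e
    ... | inj₂ ge∥e = ⊥-elim (InC-pair⇒¬∥ e (act g e) pair∈𝒞 ge∥e)

lemma5p5 : {c ℓ : Level} (G : Group c ℓ) (E : Set) (ℒ : SignVec E → Set)
    → IsFAOM ℒ → (α : GroupAction G E) → ActsOn α ℒ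
    → IsSemimatroidAction α ℒ × (Sliding α ℒ → Translative α ℒ)
lemma5p5 G E ℒ _ α acts =
  Invariant⇒IsSemimatroidAction α ℒ (ActsOn⇒Invariant α acts) ,
  Sliding⇒Translative α ℒ
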